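{- For all integers $k,n\geq 1$ and every infinite word $w\in\{1,\dots,n\}^\omega$, the $3$-cyclic $w$-word $C_3(w)$ encounters (i.e. does not avoid) the formula $\phi_k$; that is, some finite factor of $C_3(w)$ contains an occurrence of $\phi_k$.
   Context: Let $\Sigma$ be a set of variables and $\Sigma^R=\{x^R:x\in\Sigma\}$. For words, $(a_1\cdots a_n)^R=a_n\cdots a_1$. A morphism $h$ on $(\Sigma\cup\Sigma^R)^*$ respects reversal if $h(x^R)=h(x)^R$. For $k\geq1$, $\phi_k$ is the formula with reversal whose fragments are $xy_1\cdots y_kx$, $y_1^R,\dots,y_k^R$. A formula occurs in (is encountered by) a word $u$ if there is a non-erasing morphism $h$ respecting reversal such that the image of every fragment is a factor of $u$. For an infinite word $w=w_1w_2\cdots$ over positive integers and distinct letters $a_1,a_2,a_3$, $C_3(w)=a_1^{w_1}a_2^{w_2}a_3^{w_3}a_1^{w_4}a_2^{w_5}a_3^{w_6}\cdots$ (the $t$-th letter of $w$ gives the exponent of $a_{((t-1)\bmod 3)+1}$); any word obtained by bijectively renaming its letters is a $3$-cyclic $w$-word. -}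

module Defs where

open import Data.Nat using (ℕ; zero; suc)
open import Data.Nat.DivMod using (_mod_)
open import Data.Fin using (Fin; toℕ)
open import Data.List using (List; []; _∷_; _++_; [_]; reverse; concatMap; replicate; map; allFin)
open import Data.List.Relation.Unary.All using (All)
open import Data.Product using (Σ; ∃; _×_)
open import Relation.Binary.PropositionalEquality using (_≡_; _≢_)

Factor : {A : Set} → List A → List A → Set
Factor {A} u v = Σ (List A) λ p → Σ (List A) λ s → p ++ u ++ s ≡ v

data Lit (V : Set) : Set where
  var : V → Lit V
  rev : V → Lit V

Pattern : Set → Set
Pattern V = List (Lit V)

Formula : Set → Set
Formula V = List (Pattern V)

imgLit : {V A : Set} → (V → List A) → Lit V → List A
imgLit h (var x) = h x
imgLit h (rev x) = reverse (h x)

img : {V A : Set} → (V → List A) → Pattern V → List A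
img h = concatMap (imgLit h)

OccursIn : {V A : Set} → Formula V → List A → Set
OccursIn {V} {A} φ u =
  Σ (V → List A) λ h → (∀ v → h v ≢ []) × All (λ f → Factor (img h f) u) φ

-- φ_k over variables Fin (suc k): x = zero, y_i = suc i.
-- Fragments: x y_1 ⋯ y_k x , y_1^R , … , y_k^R.
phi : (k : ℕ) → Formula (Fin (suc k))
phi k = (var Fin.zero ∷ map (λ i → var (Fin.suc i)) (allFin k) ++ [ var Fin.zero ])
        ∷ map (λ i → [ rev (Fin.suc i) ]) (allFin k)

-- Infinite word over {1,…,n} : letter j ∈ Fin n stands for the integer toℕ j + 1.
-- The t-th block (t = 0,1,2,…) of C_3(w) is a_{(t mod 3)+1}^{w_t}; letters a_1,a_2,a_3
-- are the elements of Fin 3.  C3prefix w m is the prefix made of the first m blocks;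
-- finite factors of C_3(w) are exactly factors of these prefixes.
block : {n : ℕ} → (ℕ → Fin n) → ℕ → List (Fin 3)
block w t = replicate (suc (toℕ (w t))) (t mod 3)

C3prefix : {n : ℕ} → (ℕ → Fin n) → ℕ → List (Fin 3)
C3prefix w zero = []
C3prefix w (suc m) = C3prefix w m ++ block w m

-- Every block of C₃(w) is a power of one letter, hence a nonempty palindrome, so k consecutive
-- blocks can always serve as y₁ ⋯ y_k and only x has to be found on both sides of them.  For k ≡ 2 (mod 3), x is the last letter of block 0, which
-- starts block k + 1 again.  For k ≡ 0, the same works after cutting some block of length at
-- least 2 into two palindromes; if no block near the ends is that long, x = a₁a₂a₃.  For k ≡ 1,
-- x is a suffix of block s followed by block s + 1, repeated at blocks s + k + 2 and s + k + 3;
-- a suitable s exists because the exponents are bounded by n.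

module Submission where

open import Defs
open import Data.Nat using (ℕ; NonZero; zero; suc; _+_; _*_; _∸_; _≤_; _<_; _≥_; s≤s; z≤n; _≤?_; _≟_)
open import Data.Nat.Properties
  using (+-suc; +-comm; +-assoc; +-identityʳ; +-monoʳ-<; +-cancelˡ-<; +-monoʳ-≤; m≤m+n; ≤-refl; <⇒≤; <⇒≱; ≰⇒>; <-≤-trans;
         m+[n∸m]≡n; m∸n+n≡m; module ≤-Reasoning)
open import Data.Nat.DivMod using (_mod_; [m+kn]%n≡m%n)
open import Data.Fin using (Fin; toℕ)
open import Data.Fin.Properties using (fromℕ<-cong; toℕ<n)
open import Data.List using (List; length; []; _∷_; _++_; [_]; reverse; replicate; concat; map; tabulate)
open import Data.List.Properties using (length-replicate; tabulate-cong; ++-assoc; ++-identityʳ; unfold-reverse; map-tabulate; concatMap-++)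
open import Data.List.Membership.Propositional using (_∈_)
open import Data.List.Membership.Propositional.Properties using (∈-tabulate⁺)
open import Data.List.Relation.Unary.All using (All; []; _∷_; all?)
open import Data.List.Relation.Unary.All.Properties using (map⁺; tabulate⁺; ¬All⇒Any¬)
open import Data.List.Relation.Unary.Any using (here; there; satisfied)
open import Data.Product using (∃; _×_; _,_)
open import Data.Empty using (⊥-elim)
open import Function using (_∘_)
open import Relation.Nullary using (yes; no)
open import Relation.Binary.PropositionalEquality
  using (_≡_; _≢_; refl; sym; trans; cong; cong₂; subst; module ≡-Reasoning)

private variable
  A : Set

Palindrome : List A → Set
Palindrome u = reverse u ≡ u

Factor-refl : (u : List A) → Factor u u
Factor-refl u = [] , [] , ++-identityʳ u

Factor-trans : {u v w : List A} → Factor u v → Factor v w → Factor u w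
Factor-trans {u = u} (p , s , refl) (p′ , s′ , refl) = p′ ++ p , s ++ s′ , eq
  where
  open ≡-Reasoning
  eq : (p′ ++ p) ++ u ++ s ++ s′ ≡ p′ ++ (p ++ u ++ s) ++ s′
  eq = begin
    (p′ ++ p) ++ u ++ s ++ s′   ≡⟨ ++-assoc p′ p _ ⟩
    p′ ++ p ++ u ++ s ++ s′     ≡⟨ cong (λ v → p′ ++ p ++ v) (++-assoc u s s′) ⟨
    p′ ++ p ++ (u ++ s) ++ s′   ≡⟨ cong (p′ ++_) (++-assoc p (u ++ s) s′) ⟨
    p′ ++ (p ++ u ++ s) ++ s′   ∎

∈⇒Factor-concat : {u : List A} {us : List (List A)} → u ∈ us → Factor u (concat us)
∈⇒Factor-concat {us = u ∷ us} (here refl) = [] , concat us , refl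
∈⇒Factor-concat {us = u′ ∷ us} (there u∈us) with ∈⇒Factor-concat u∈us
... | p , s , eq = u′ ++ p , s , trans (++-assoc u′ p _) (cong (u′ ++_) eq)

Factor-bridge : (x M : List A) {v₁ v₂ p s : List A} → v₁ ≡ p ++ x → v₂ ≡ x ++ s →
                Factor (x ++ M ++ x) (v₁ ++ M ++ v₂)
Factor-bridge x M {p = p} {s} refl refl = p , s , eq
  where
  open ≡-Reasoning
  eq : p ++ (x ++ M ++ x) ++ s ≡ (p ++ x) ++ M ++ x ++ s
  eq = begin
    p ++ (x ++ M ++ x) ++ s   ≡⟨ cong (p ++_) (++-assoc x (M ++ x) s) ⟩
    p ++ x ++ (M ++ x) ++ s   ≡⟨ cong (λ v → p ++ x ++ v) (++-assoc M x s) ⟩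
    p ++ x ++ M ++ x ++ s     ≡⟨ ++-assoc p x _ ⟨
    (p ++ x) ++ M ++ x ++ s   ∎

replicate-+ : ∀ m n (c : A) → replicate (m + n) c ≡ replicate m c ++ replicate n c
replicate-+ zero    n c = refl
replicate-+ (suc m) n c = cong (c ∷_) (replicate-+ m n c)

replicate-prefix : ∀ {m n} (c : A) → m ≤ n → replicate n c ≡ replicate m c ++ replicate (n ∸ m) c
replicate-prefix {m = m} {n} c m≤n =
  trans (cong (λ l → replicate l c) (sym (m+[n∸m]≡n m≤n))) (replicate-+ m (n ∸ m) c)

replicate-suffix : ∀ {m n} (c : A) → m ≤ n → replicate n c ≡ replicate (n ∸ m) c ++ replicate m c
replicate-suffix {m = m} {n} c m≤n =
  trans (cong (λ l → replicate l c) (sym (m∸n+n≡m m≤n))) (replicate-+ (n ∸ m) m c)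

replicate-palindrome : ∀ n (c : A) → Palindrome (replicate n c)
replicate-palindrome zero    c = refl
replicate-palindrome (suc n) c = begin
  reverse (c ∷ replicate n c)        ≡⟨ unfold-reverse c (replicate n c) ⟩
  reverse (replicate n c) ++ [ c ]   ≡⟨ cong (_++ [ c ]) (replicate-palindrome n c) ⟩
  replicate n c ++ replicate 1 c     ≡⟨ replicate-+ n 1 c ⟨
  replicate (n + 1) c                ≡⟨ cong (λ l → replicate l c) (+-comm n 1) ⟩
  replicate (suc n) c                ∎
  where open ≡-Reasoning

phi-occurs : ∀ {k} {u : List A} (x M : List A) (ys : Fin k → List A) →
             x ≢ [] → (∀ i → ys i ≢ []) → (∀ i → Palindrome (ys i)) →
             concat (tabulate ys) ≡ M → Factor (x ++ M ++ x) u → OccursIn (phi k) u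
phi-occurs {A = A} {k} {u} x M ys x≢[] ys≢[] ys-palindromes refl xMx =
  h , h≢[] , subst (λ v → Factor v u) (sym first-fragment-image) xMx ∷ map⁺ (tabulate⁺ ys-reversed)
  where
  h : Fin (suc k) → List A
  h Fin.zero    = x
  h (Fin.suc i) = ys i

  h≢[] : ∀ v → h v ≢ []
  h≢[] Fin.zero    = x≢[]
  h≢[] (Fin.suc i) = ys≢[] i

  first-fragment-image : img h (var Fin.zero ∷ map (var ∘ Fin.suc) (tabulate (λ i → i)) ++ [ var Fin.zero ])
                   ≡ x ++ M ++ x
  first-fragment-image = cong (x ++_) (begin
    img h (map (var ∘ Fin.suc) (tabulate (λ i → i)) ++ [ var Fin.zero ])
      ≡⟨ concatMap-++ (imgLit h) (map (var ∘ Fin.suc) (tabulate (λ i → i))) _ ⟩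
    img h (map (var ∘ Fin.suc) (tabulate (λ i → i))) ++ x ++ []
      ≡⟨ cong₂ _++_ (cong (concat ∘ map (imgLit h)) (map-tabulate (λ i → i) (var ∘ Fin.suc))) (++-identityʳ x) ⟩
    concat (map (imgLit h) (tabulate (var ∘ Fin.suc))) ++ x
      ≡⟨ cong (λ v → concat v ++ x) (map-tabulate (var ∘ Fin.suc) (imgLit h)) ⟩
    concat (tabulate ys) ++ x
      ∎)
    where open ≡-Reasoning

  M-Factor : Factor M u
  M-Factor = Factor-trans (x , x , refl) xMx

  ys-reversed : ∀ i → Factor (img h [ rev (Fin.suc i) ]) u
  ys-reversed i = subst (λ v → Factor v u)
    (sym (trans (++-identityʳ (reverse (ys i))) (ys-palindromes i)))
    (Factor-trans (∈⇒Factor-concat (∈-tabulate⁺ i)) M-Factor)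

module _ (g : ℕ → ℕ) (D : ℕ) where

  Drop : ℕ → Set
  Drop t = g (t + D) ≤ g t

  Rise : ℕ → Set
  Rise t = g t ≤ g (t + D)

  window : ℕ → ℕ → ℕ
  window t zero    = 0
  window t (suc l) = g t + window (suc t) l

  window-slide : ∀ t l → window t l + g (t + l) ≡ g t + window (suc t) l
  window-slide t zero    = trans (cong g (+-identityʳ t)) (sym (+-identityʳ (g t)))
  window-slide t (suc l) = begin
    (g t + window (suc t) l) + g (t + suc l)   ≡⟨ +-assoc (g t) _ _ ⟩
    g t + (window (suc t) l + g (t + suc l))   ≡⟨ cong (λ i → g t + (window (suc t) l + g i)) (+-suc t l) ⟩
    g t + (window (suc t) l + g (suc t + l))   ≡⟨ cong (g t +_) (window-slide (suc t) l) ⟩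
    g t + window (suc t) (suc l)               ∎
    where open ≡-Reasoning

  strict-drop⇒window-decreases : ∀ t → g (t + D) < g t → window (suc t) D < window t D
  strict-drop⇒window-decreases t drop = +-cancelˡ-< (g t) _ _ (begin-strict
    g t + window (suc t) D   ≡⟨ window-slide t D ⟨
    window t D + g (t + D)   <⟨ +-monoʳ-< (window t D) drop ⟩
    window t D + g t         ≡⟨ +-comm (window t D) (g t) ⟩
    g t + window t D         ∎)
    where open ≤-Reasoning

  -- Failing to rise at suc t is a strict drop there, which shrinks the window sum bounded by b.
  rise-after-drop : ∀ b t → window (suc t) D < b → Drop t → ∃ λ s → Drop s × Rise (suc s)
  rise-after-drop (suc b) t (s≤s window≤b) t-drop with g (suc t) ≤? g (suc t + D)
  ... | yes t-rise = t , t-drop , t-rise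
  ... | no ¬t-rise = rise-after-drop b (suc t)
        (<-≤-trans (strict-drop⇒window-decreases (suc t) (≰⇒> ¬t-rise)) window≤b)
        (<⇒≤ (≰⇒> ¬t-rise))

  module _ {n : ℕ} (g<n : ∀ t → g t < n) where

    -- Without a drop, g would increase strictly along t, t + D, t + 2D, …
    drop-exists : ∀ b t → n ≤ b + g t → ∃ Drop
    drop-exists b t n≤b+gt with g (t + D) ≤? g t
    ... | yes t-drop = t , t-drop
    drop-exists zero    t n≤gt   | no _ = ⊥-elim (<⇒≱ (g<n t) n≤gt)
    drop-exists (suc b) t n≤b+gt | no ¬t-drop = drop-exists b (t + D) (begin
      n                ≤⟨ n≤b+gt ⟩
      suc b + g t      ≡⟨ +-suc b (g t) ⟨
      b + suc (g t)    ≤⟨ +-monoʳ-≤ b (≰⇒> ¬t-drop) ⟩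
      b + g (t + D)    ∎)
      where open ≤-Reasoning

    drop-then-rise-exists : ∃ λ s → Drop s × Rise (suc s)
    drop-then-rise-exists with drop-exists n 0 (m≤m+n n (g 0))
    ... | t , t-drop = rise-after-drop (suc (window (suc t) D)) t ≤-refl t-drop

mod-periodic : ∀ m k n .{{_ : NonZero n}} → (m + k * n) mod n ≡ m mod n
mod-periodic m k n = fromℕ<-cong _ _ ([m+kn]%n≡m%n m k n) _ _

module _ {n : ℕ} (w : ℕ → Fin n) where

  private
    colour : ℕ → Fin 3
    colour t = t mod 3

    -- one less than the paper's exponent w_t, i.e. block t has suc (exponent t) letters
    exponent : ℕ → ℕ
    exponent t = toℕ (w t)

    B : ℕ → List (Fin 3)
    B = block w

  block-nonempty : ∀ t → B t ≢ []
  block-nonempty t ()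

  block-palindrome : ∀ t → Palindrome (B t)
  block-palindrome t = replicate-palindrome _ _

  segment : ℕ → ℕ → List (Fin 3)
  segment a zero    = []
  segment a (suc l) = B a ++ segment (suc a) l

  C3prefix-+ : ∀ a l → C3prefix w (a + l) ≡ C3prefix w a ++ segment a l
  C3prefix-+ a zero    = trans (cong (C3prefix w) (+-identityʳ a)) (sym (++-identityʳ _))
  C3prefix-+ a (suc l) = begin
    C3prefix w (a + suc l)                    ≡⟨ cong (C3prefix w) (+-suc a l) ⟩
    C3prefix w (suc a + l)                    ≡⟨ C3prefix-+ (suc a) l ⟩
    (C3prefix w a ++ B a) ++ segment (suc a) l  ≡⟨ ++-assoc (C3prefix w a) (B a) _ ⟩
    C3prefix w a ++ segment a (suc l)          ∎
    where open ≡-Reasoning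

  segment-+ : ∀ a l₁ l₂ → segment a (l₁ + l₂) ≡ segment a l₁ ++ segment (a + l₁) l₂
  segment-+ a zero     l₂ = cong (λ b → segment b l₂) (sym (+-identityʳ a))
  segment-+ a (suc l₁) l₂ = begin
    B a ++ segment (suc a) (l₁ + l₂)                          ≡⟨ cong (B a ++_) (segment-+ (suc a) l₁ l₂) ⟩
    B a ++ segment (suc a) l₁ ++ segment (suc a + l₁) l₂      ≡⟨ cong (λ b → B a ++ segment (suc a) l₁ ++ segment b l₂) (+-suc a l₁) ⟨
    B a ++ segment (suc a) l₁ ++ segment (a + suc l₁) l₂      ≡⟨ ++-assoc (B a) _ _ ⟨
    (B a ++ segment (suc a) l₁) ++ segment (a + suc l₁) l₂    ∎
    where open ≡-Reasoning

  Factor-segment : ∀ a l {u v} → segment a l ≡ v → Factor u v → Factor u (C3prefix w (a + l))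
  Factor-segment a l refl u⊑v =
    Factor-trans u⊑v (C3prefix w a , [] , trans (cong (C3prefix w a ++_) (++-identityʳ _)) (sym (C3prefix-+ a l)))

  concat-blocks : ∀ a l → concat (tabulate {n = l} (λ i → B (a + toℕ i))) ≡ segment a l
  concat-blocks a zero    = refl
  concat-blocks a (suc l) = cong₂ _++_ (cong B (+-identityʳ a))
    (trans (cong concat (tabulate-cong {n = l} (λ i → cong B (+-suc a (toℕ i))))) (concat-blocks (suc a) l))

  letter-bridge : ∀ a l → colour (suc a + l) ≡ colour a →
                  Factor ([ colour a ] ++ segment (suc a) l ++ [ colour a ]) (C3prefix w (a + suc (l + 1)))
  letter-bridge a l same = Factor-segment a (suc (l + 1)) (cong (B a ++_) (segment-+ (suc a) l 1))
    (Factor-bridge [ colour a ] (segment (suc a) l) (replicate-suffix {n = suc (exponent a)} (colour a) (s≤s z≤n)) (cong (_∷ rest) same))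
    where rest = replicate (exponent (suc a + l)) (colour (suc a + l)) ++ []

  phi-occurs-2+3j : ∀ j → ∃ λ m → OccursIn (phi (2 + j * 3)) (C3prefix w m)
  phi-occurs-2+3j j = _ , phi-occurs [ colour 0 ] (segment 1 k) (λ i → B (1 + toℕ i))
    (λ ()) (λ i → block-nonempty _) (λ i → block-palindrome _) (concat-blocks 1 k)
    (letter-bridge 0 k (mod-periodic 0 (suc j) 3))
    where k = 2 + j * 3

  -- Block s + 1 is cut into its first letter and the rest, so that k - 1 blocks supply k palindromes.
  phi-occurs-3+3j-long : ∀ j s → exponent (suc s) ≢ 0 → ∃ λ m → OccursIn (phi (3 + j * 3)) (C3prefix w m)
  phi-occurs-3+3j-long j s long = s + suc (suc K + 1) , phi-occurs [ colour s ] (segment (suc s) (suc K)) ys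
    (λ ()) ys≢[] ys-palindromes (cong (B (suc s) ++_) (concat-blocks (2 + s) K))
    (letter-bridge s (suc K) (trans (cong colour (sym (+-suc s (suc K)))) (mod-periodic s (suc j) 3)))
    where
    K = 1 + j * 3
    ys : Fin (2 + K) → List (Fin 3)
    ys Fin.zero                = [ colour (suc s) ]
    ys (Fin.suc Fin.zero)      = replicate (exponent (suc s)) (colour (suc s))
    ys (Fin.suc (Fin.suc i))   = B (2 + s + toℕ i)

    ys≢[] : ∀ i → ys i ≢ []
    ys≢[] Fin.zero              = λ ()
    ys≢[] (Fin.suc Fin.zero) eq = long (trans (sym (length-replicate _)) (cong length eq))
    ys≢[] (Fin.suc (Fin.suc i)) = block-nonempty _

    ys-palindromes : ∀ i → Palindrome (ys i)
    ys-palindromes Fin.zero              = refl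
    ys-palindromes (Fin.suc Fin.zero)    = replicate-palindrome _ _
    ys-palindromes (Fin.suc (Fin.suc i)) = block-palindrome _

  short-block : ∀ t → exponent t ≡ 0 → B t ≡ [ colour t ]
  short-block t e = cong (λ l → replicate (suc l) (colour t)) e

  segment-of-short-blocks : ∀ a → exponent a ≡ 0 → exponent (1 + a) ≡ 0 → exponent (2 + a) ≡ 0 →
                            segment a 3 ≡ colour a ∷ colour (1 + a) ∷ colour (2 + a) ∷ []
  segment-of-short-blocks a e₀ e₁ e₂ =
    cong₂ _++_ (short-block a e₀) (cong₂ _++_ (short-block (1 + a) e₁) (cong (_++ []) (short-block (2 + a) e₂)))

  phi-occurs-3+3j-short : ∀ j → let k = 3 + j * 3 in
    All (λ t → exponent (suc t) ≡ 0) (0 ∷ 1 ∷ 2 ∷ 3 + k ∷ 4 + k ∷ 5 + k ∷ []) →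
    ∃ λ m → OccursIn (phi k) (C3prefix w m)
  phi-occurs-3+3j-short j (e₁ ∷ e₂ ∷ e₃ ∷ e₄ ∷ e₅ ∷ e₆ ∷ []) = _ ,
    phi-occurs (segment 1 3) (segment 4 k) (λ i → B (4 + toℕ i))
      (λ ()) (λ i → block-nonempty _) (λ i → block-palindrome _) (concat-blocks 4 k)
      (Factor-segment 1 (3 + (k + 3)) shape (Factor-refl _))
    where
    open ≡-Reasoning
    k = 3 + j * 3
    repeated : segment (4 + k) 3 ≡ segment 1 3
    repeated = begin
      segment (4 + k) 3                                      ≡⟨ segment-of-short-blocks (4 + k) e₄ e₅ e₆ ⟩
      colour (4 + k) ∷ colour (5 + k) ∷ colour (6 + k) ∷ []  ≡⟨ cong₂ (λ c d → c ∷ d ∷ colour (6 + k) ∷ [])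
                                                                   (mod-periodic 1 (2 + j) 3) (mod-periodic 2 (2 + j) 3) ⟩
      colour 1 ∷ colour 2 ∷ colour (6 + k) ∷ []              ≡⟨ cong (λ c → colour 1 ∷ colour 2 ∷ c ∷ []) (mod-periodic 3 (2 + j) 3) ⟩
      colour 1 ∷ colour 2 ∷ colour 3 ∷ []                    ≡⟨ segment-of-short-blocks 1 e₁ e₂ e₃ ⟨
      segment 1 3                                            ∎
    shape : segment 1 (3 + (k + 3)) ≡ segment 1 3 ++ segment 4 k ++ segment 1 3
    shape = begin
      segment 1 (3 + (k + 3))                         ≡⟨ segment-+ 1 3 (k + 3) ⟩
      segment 1 3 ++ segment 4 (k + 3)                ≡⟨ cong (segment 1 3 ++_) (segment-+ 4 k 3) ⟩
      segment 1 3 ++ segment 4 k ++ segment (4 + k) 3 ≡⟨ cong (λ v → segment 1 3 ++ segment 4 k ++ v) repeated ⟩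
      segment 1 3 ++ segment 4 k ++ segment 1 3       ∎

  phi-occurs-3+3j : ∀ j → ∃ λ m → OccursIn (phi (3 + j * 3)) (C3prefix w m)
  phi-occurs-3+3j j with all? (λ t → exponent (suc t) ≟ 0) (0 ∷ 1 ∷ 2 ∷ 6 + j * 3 ∷ 7 + j * 3 ∷ 8 + j * 3 ∷ [])
  ... | yes short = phi-occurs-3+3j-short j short
  ... | no ¬short with satisfied (¬All⇒Any¬ (λ t → exponent (suc t) ≟ 0) _ ¬short)
  ...   | s , long = phi-occurs-3+3j-long j s long

  -- Drop lets block s end with block s + D, Rise lets block s + D + 1 start with block s + 1.
  phi-occurs-at-drop-rise : ∀ k s → (∀ t → colour (t + (2 + k)) ≡ colour t) →
    Drop exponent (2 + k) s → Rise exponent (2 + k) (suc s) → ∃ λ m → OccursIn (phi k) (C3prefix w m)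
  phi-occurs-at-drop-rise k s period drop rise = s + (2 + (k + 2)) ,
    phi-occurs x (segment (2 + s) k) (λ i → B (2 + s + toℕ i))
      (λ ()) (λ i → block-nonempty _) (λ i → block-palindrome _) (concat-blocks (2 + s) k)
      (Factor-segment s (2 + (k + 2)) shape (Factor-bridge x (segment (2 + s) k) ends starts))
    where
    open ≡-Reasoning
    D = 2 + k
    α = suc (exponent (s + D))
    β = suc (exponent (suc s + D))
    x = replicate α (colour s) ++ B (suc s)
    rest = replicate (β ∸ suc (exponent (suc s))) (colour (suc s))

    ends : B s ++ B (suc s) ≡ replicate (suc (exponent s) ∸ α) (colour s) ++ x
    ends = trans (cong (_++ B (suc s)) (replicate-suffix (colour s) (s≤s drop)))
                 (++-assoc (replicate (suc (exponent s) ∸ α) (colour s)) (replicate α (colour s)) (B (suc s)))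

    starts : B (s + D) ++ B (suc s + D) ++ [] ≡ x ++ rest ++ []
    starts = begin
      B (s + D) ++ B (suc s + D) ++ []                      ≡⟨ cong₂ (λ c d → replicate α c ++ replicate β d ++ [])
                                                                  (period s) (period (suc s)) ⟩
      replicate α (colour s) ++ replicate β (colour (suc s)) ++ []
                                                            ≡⟨ cong (λ v → replicate α (colour s) ++ v ++ [])
                                                                  (replicate-prefix (colour (suc s)) (s≤s rise)) ⟩
      replicate α (colour s) ++ (B (suc s) ++ rest) ++ []   ≡⟨ cong (replicate α (colour s) ++_) (++-assoc (B (suc s)) rest []) ⟩
      replicate α (colour s) ++ B (suc s) ++ rest ++ []     ≡⟨ ++-assoc (replicate α (colour s)) (B (suc s)) _ ⟨
      x ++ rest ++ []                                       ∎

    shape : segment s (2 + (k + 2)) ≡ (B s ++ B (suc s)) ++ segment (2 + s) k ++ B (s + D) ++ B (suc s + D) ++ []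
    shape = begin
      B s ++ B (suc s) ++ segment (2 + s) (k + 2)                        ≡⟨ cong (λ v → B s ++ B (suc s) ++ v) (segment-+ (2 + s) k 2) ⟩
      B s ++ B (suc s) ++ segment (2 + s) k ++ segment (2 + s + k) 2     ≡⟨ cong (λ t → B s ++ B (suc s) ++ segment (2 + s) k ++ segment t 2)
                                                                             (sym (trans (+-suc s (suc k)) (cong suc (+-suc s k)))) ⟩
      B s ++ B (suc s) ++ segment (2 + s) k ++ segment (s + D) 2         ≡⟨ ++-assoc (B s) (B (suc s)) _ ⟨
      (B s ++ B (suc s)) ++ segment (2 + s) k ++ B (s + D) ++ B (suc s + D) ++ [] ∎

  phi-occurs-1+3j : ∀ j → ∃ λ m → OccursIn (phi (1 + j * 3)) (C3prefix w m)
  phi-occurs-1+3j j with drop-then-rise-exists exponent (3 + j * 3) (toℕ<n ∘ w)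
  ... | s , drop , rise = phi-occurs-at-drop-rise (1 + j * 3) s (λ t → mod-periodic t (suc j) 3) drop rise

data Residue₃ : ℕ → Set where
  1+3j : ∀ j → Residue₃ (1 + j * 3)
  2+3j : ∀ j → Residue₃ (2 + j * 3)
  3+3j : ∀ j → Residue₃ (3 + j * 3)

residue₃ : ∀ k → k ≥ 1 → Residue₃ k
residue₃ 1 _ = 1+3j 0
residue₃ 2 _ = 2+3j 0
residue₃ 3 _ = 3+3j 0
residue₃ (suc (suc (suc (suc k)))) _ with residue₃ (suc k) (s≤s z≤n)
... | 1+3j j = 1+3j (suc j)
... | 2+3j j = 2+3j (suc j)
... | 3+3j j = 3+3j (suc j)

lemma4p1 : (k n : ℕ) → k ≥ 1 → n ≥ 1 → (w : ℕ → Fin n) →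
    ∃ λ m → OccursIn (phi k) (C3prefix w m)
lemma4p1 k n k≥1 _ w with residue₃ k k≥1
... | 1+3j j = phi-occurs-1+3j w j
... | 2+3j j = phi-occurs-2+3j w j
... | 3+3j j = phi-occurs-3+3j w j
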